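{- Let $Q$ be an involutive residuated lattice in which $0=1$, and let $d\ge2$. For $f\in Q^{\mathcal{C}_d}$ define $\delta_f:\{1,\dots,d\}^2\to Q$ by $\delta_f(i,j)=f_{i,j}$ if $i<j$, $\delta_f(i,i)=0$, and $\delta_f(i,j)=(f_{j,i})^{*}$ if $j<i$. Then $f$ is clopen if and only if $\delta_f$ is a skew metric on $\{1,\dots,d\}$ with values in $Q$.
   Context: An involutive residuated lattice is a structure $\langle Q,\bot,\vee,\top,\wedge,1,\otimes,0,{}^{*}\rangle$ where $\langle Q,\bot,\vee,\top,\wedge\rangle$ is a bounded lattice, $\otimes$ is an associative operation with unit $1$ distributing over finite joins, ${}^{*}$ is an order-reversing involution of $Q$, $0:=1^{*}$, $\alpha\oplus\beta:=(\beta^{*}\otimes\alpha^{*})^{*}$, and for all $\alpha,\beta,\gamma$: $\alpha\otimes\beta\le\gamma$ iff $\alpha\le\gamma\oplus\beta^{*}$ iff $\beta\le\alpha^{*}\oplus\gamma$. Let $\mathcal{C}_d=\{(i,j):1\le i<j\le d\}$; $f\in Q^{\mathcal{C}_d}$ is clopen if $f_{i,j}\otimes f_{j,k}\le f_{i,k}\le f_{i,j}\oplus f_{j,k}$ for all $1\le i<j<k\le d$. A skew metric on a set $X$ with values in $Q$ is a map $\delta:X\times X\to Q$ with $\delta(x,x)\le0$, $\delta(x,z)\le\delta(x,y)\oplus\delta(y,z)$ and $\delta(x,y)=\delta(y,x)^{*}$ for all $x,y,z\in X$. -}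

module Defs where

open import Level using (Level; suc; _⊔_)
open import Data.Nat using (ℕ; _≥_)
open import Data.Fin using (Fin; _<_)
open import Data.Product using (_×_; Σ)
open import Relation.Binary.PropositionalEquality using (_≡_)
open import Relation.Binary.Structures using (IsPartialOrder)
open import Relation.Binary.Definitions using (Trichotomous; tri<; tri≈; tri>)
open import Data.Fin.Properties using (<-cmp)
open import Function.Bundles using (_⇔_)

record InvResLattice (c ℓ : Level) : Set (suc (c ⊔ ℓ)) where
  infix  4 _≤_
  infixr 6 _∨_
  infixr 7 _∧_
  infixl 8 _⊗_
  field
    Carrier : Set c
    _≤_     : Carrier → Carrier → Set ℓ
    isPartialOrder : IsPartialOrder _≡_ _≤_
    ⊥ ⊤     : Carrier
    _∨_ _∧_ : Carrier → Carrier → Carrier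
    ⊥-min   : ∀ a → ⊥ ≤ a
    ⊤-max   : ∀ a → a ≤ ⊤
    ∨-upperˡ : ∀ a b → a ≤ a ∨ b
    ∨-upperʳ : ∀ a b → b ≤ a ∨ b
    ∨-least  : ∀ a b c → a ≤ c → b ≤ c → a ∨ b ≤ c
    ∧-lowerˡ : ∀ a b → a ∧ b ≤ a
    ∧-lowerʳ : ∀ a b → a ∧ b ≤ b
    ∧-greatest : ∀ a b c → c ≤ a → c ≤ b → c ≤ a ∧ b
    1#      : Carrier
    _⊗_     : Carrier → Carrier → Carrier
    ⊗-assoc : ∀ a b c → (a ⊗ b) ⊗ c ≡ a ⊗ (b ⊗ c)
    ⊗-identityˡ : ∀ a → 1# ⊗ a ≡ a
    ⊗-identityʳ : ∀ a → a ⊗ 1# ≡ a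
    ⊗-zeroˡ : ∀ a → ⊥ ⊗ a ≡ ⊥
    ⊗-zeroʳ : ∀ a → a ⊗ ⊥ ≡ ⊥
    ⊗-distribˡ-∨ : ∀ a b c → a ⊗ (b ∨ c) ≡ (a ⊗ b) ∨ (a ⊗ c)
    ⊗-distribʳ-∨ : ∀ a b c → (b ∨ c) ⊗ a ≡ (b ⊗ a) ∨ (c ⊗ a)
    _*      : Carrier → Carrier
    *-antitone : ∀ a b → a ≤ b → b * ≤ a *
    *-involutive : ∀ a → (a *) * ≡ a

  0# : Carrier
  0# = 1# *

  _⊕_ : Carrier → Carrier → Carrier
  a ⊕ b = ((b *) ⊗ (a *)) *

  field
    residuationˡ : ∀ a b c → (a ⊗ b ≤ c) ⇔ (a ≤ c ⊕ (b *))
    residuationʳ : ∀ a b c → (a ⊗ b ≤ c) ⇔ (b ≤ (a *) ⊕ c)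

module _ {c ℓ : Level} (Q : InvResLattice c ℓ) where
  open InvResLattice Q

  -- f ∈ Q^{C_d}: values on pairs (i , j) with i < j, indices in Fin d ≅ {1..d}
  Cfun : ℕ → Set c
  Cfun d = (i j : Fin d) → i < j → Carrier

  IsClopen : ∀ {d} → Cfun d → Set ℓ
  IsClopen f = ∀ i j k (ij : i < j) (jk : j < k) (ik : i < k) →
    (f i j ij ⊗ f j k jk ≤ f i k ik) × (f i k ik ≤ f i j ij ⊕ f j k jk)

  δ : ∀ {d} → Cfun d → Fin d → Fin d → Carrier
  δ f i j with <-cmp i j
  ... | tri< i<j _ _ = f i j i<j
  ... | tri≈ _ _ _   = 0#
  ... | tri> _ _ j<i = (f j i j<i) *

  IsSkewMetric : {X : Set} → (X → X → Carrier) → Set (c ⊔ ℓ)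
  IsSkewMetric {X} δ′ =
    (∀ x → δ′ x x ≤ 0#) ×
    (∀ x y z → δ′ x z ≤ δ′ x y ⊕ δ′ y z) ×
    (∀ x y → δ′ x y ≡ (δ′ y x) *)

module Submission where

-- For pairwise distinct x, y, z, the triangle inequality δ(x,z) ≤ δ(x,y) ⊕ δ(y,z) is,
-- through residuation and the involution (which together rotate c ≤ a ⊕ b into
-- a* ≤ b ⊕ c* and b* ≤ c* ⊕ a), exactly one of the two clopen inequalities for the
-- sorted triple; which one depends on the order of x, y, z. Repeated points only need
-- 0 to be the unit of ⊕, 0 ≤ a ⊕ a* and 0* = 0; the last two are where 0 = 1 enters
-- (in general only 1 ≤ a ⊕ a* and 0* = 1 hold).

open import Defs
open import Data.Nat using (ℕ; _≥_)
open import Data.Fin using (Fin; _<_)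
open import Data.Fin.Properties using (<-cmp; <-irrelevant; <-irrefl; <-asym; <-trans)
open import Data.Product using (_,_; proj₁; proj₂)
open import Data.Empty using (⊥-elim)
open import Relation.Binary.PropositionalEquality using (_≡_; refl; sym; trans; cong; cong₂; subst)
open import Relation.Binary.Structures using (IsPartialOrder)
open import Relation.Binary.Definitions using (Tri; tri<; tri≈; tri>)
open import Function.Bundles using (_⇔_; mk⇔; Equivalence)

module InvResLatticeProperties {c ℓ} (Q : InvResLattice c ℓ) where
  open InvResLattice Q

  ≤-reflexive : ∀ {a b} → a ≡ b → a ≤ b
  ≤-reflexive = IsPartialOrder.reflexive isPartialOrder

  ⊗-≤⇒≤-⊕ˡ : ∀ {a b c} → a ⊗ b ≤ c → a ≤ c ⊕ (b *)
  ⊗-≤⇒≤-⊕ˡ = Equivalence.to (residuationˡ _ _ _)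

  ⊗-≤⇒≤-⊕ʳ : ∀ {a b c} → a ⊗ b ≤ c → b ≤ (a *) ⊕ c
  ⊗-≤⇒≤-⊕ʳ = Equivalence.to (residuationʳ _ _ _)

  ≤-⊕⇒⊗-≤ˡ : ∀ {a b c} → a ≤ c ⊕ (b *) → a ⊗ b ≤ c
  ≤-⊕⇒⊗-≤ˡ = Equivalence.from (residuationˡ _ _ _)

  ⊕-identityˡ : ∀ a → 0# ⊕ a ≡ a
  ⊕-identityˡ a = trans (cong (λ t → ((a *) ⊗ t) *) (*-involutive 1#))
                        (trans (cong _* (⊗-identityʳ (a *))) (*-involutive a))

  ⊕-identityʳ : ∀ a → a ⊕ 0# ≡ a
  ⊕-identityʳ a = trans (cong (λ t → (t ⊗ (a *)) *) (*-involutive 1#))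
                        (trans (cong _* (⊗-identityˡ (a *))) (*-involutive a))

  *-antidistrib-⊗ : ∀ a b → (b ⊗ a) * ≡ (a *) ⊕ (b *)
  *-antidistrib-⊗ a b = cong₂ (λ u v → (u ⊗ v) *) (sym (*-involutive b)) (sym (*-involutive a))

  *-antidistrib-⊕ : ∀ a b → (a ⊕ b) * ≡ (b *) ⊗ (a *)
  *-antidistrib-⊕ a b = *-involutive _

  1≤⊕* : ∀ a → 1# ≤ a ⊕ (a *)
  1≤⊕* a = ⊗-≤⇒≤-⊕ˡ (≤-reflexive (⊗-identityˡ a))

  ⊗-≤⇒*-≤-⊕ : ∀ {a b c} → a ⊗ b ≤ c → c * ≤ (b *) ⊕ (a *)
  ⊗-≤⇒*-≤-⊕ {a} {b} {c} ab≤c = subst (c * ≤_) (*-antidistrib-⊗ b a) (*-antitone _ _ ab≤c)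

  ≤-⊕⇒*-⊗-≤ : ∀ {a b c} → c ≤ a ⊕ b → (b *) ⊗ (a *) ≤ c *
  ≤-⊕⇒*-⊗-≤ {a} {b} {c} c≤a⊕b = subst (_≤ c *) (*-antidistrib-⊕ a b) (*-antitone _ _ c≤a⊕b)

  ⊕-rotateˡ : ∀ {a b c} → c ≤ a ⊕ b → b * ≤ (c *) ⊕ a
  ⊕-rotateˡ {a} c≤a⊕b = subst (λ t → _ ≤ _ ⊕ t) (*-involutive a) (⊗-≤⇒≤-⊕ˡ (≤-⊕⇒*-⊗-≤ c≤a⊕b))

  ⊕-rotateʳ : ∀ {a b c} → c ≤ a ⊕ b → a * ≤ b ⊕ (c *)
  ⊕-rotateʳ {b = b} c≤a⊕b = subst (λ t → _ ≤ t ⊕ _) (*-involutive b) (⊗-≤⇒≤-⊕ʳ (≤-⊕⇒*-⊗-≤ c≤a⊕b))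

module _ {c ℓ} (Q : InvResLattice c ℓ) {d : ℕ} (f : Cfun Q d) where
  open InvResLattice Q
  open InvResLatticeProperties Q

  private
    δf : Fin d → Fin d → Carrier
    δf = δ Q f

  f-irrelevant : ∀ {i j} (p q : i < j) → f i j p ≡ f i j q
  f-irrelevant p q = cong (f _ _) (<-irrelevant p q)

  δ-< : ∀ {i j} (i<j : i < j) → δf i j ≡ f i j i<j
  δ-< {i} {j} i<j with <-cmp i j
  ... | tri< p _ _ = f-irrelevant p i<j
  ... | tri≈ _ i≡j _ = ⊥-elim (<-irrefl i≡j i<j)
  ... | tri> _ _ j<i = ⊥-elim (<-asym i<j j<i)

  δ-> : ∀ {i j} (j<i : j < i) → δf i j ≡ (f j i j<i) *
  δ-> {i} {j} j<i with <-cmp i j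
  ... | tri< i<j _ _ = ⊥-elim (<-asym i<j j<i)
  ... | tri≈ _ i≡j _ = ⊥-elim (<-irrefl (sym i≡j) j<i)
  ... | tri> _ _ p = cong _* (f-irrelevant p j<i)

  δ-diagonal : ∀ i → δf i i ≡ 0#
  δ-diagonal i with <-cmp i i
  ... | tri< i<i _ _ = ⊥-elim (<-irrefl refl i<i)
  ... | tri≈ _ _ _ = refl
  ... | tri> _ _ i<i = ⊥-elim (<-irrefl refl i<i)

  ≤-⊕-cong : ∀ {a b c a′ b′ c′} → a ≡ a′ → b ≡ b′ → c ≡ c′ → a′ ≤ b′ ⊕ c′ → a ≤ b ⊕ c
  ≤-⊕-cong refl refl refl h = h

  skewMetric⇒clopen : IsSkewMetric Q δf → IsClopen Q f
  skewMetric⇒clopen (_ , triangle , _) i j k ij jk ik =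
      ≤-⊕⇒⊗-≤ˡ (≤-⊕-cong (sym (δ-< ij)) (sym (δ-< ik)) (sym (δ-> jk)) (triangle i k j))
    , ≤-⊕-cong (sym (δ-< ik)) (sym (δ-< ij)) (sym (δ-< jk)) (triangle i j k)

  module _ (0≡1 : 0# ≡ 1#) where

    0≤⊕* : ∀ a → 0# ≤ a ⊕ (a *)
    0≤⊕* a = subst (_≤ _) (sym 0≡1) (1≤⊕* a)

    0*≡0 : 0# * ≡ 0#
    0*≡0 = trans (*-involutive 1#) (sym 0≡1)

    δ-skew : ∀ i j → δf i j ≡ (δf j i) *
    δ-skew i j with <-cmp i j
    ... | tri< i<j _ _ = trans (sym (*-involutive _)) (cong _* (sym (δ-> i<j)))
    ... | tri≈ _ refl _ = trans (sym 0*≡0) (cong _* (sym (δ-diagonal i)))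
    ... | tri> _ _ j<i = cong _* (sym (δ-< j<i))

    clopen⇒triangle : IsClopen Q f → ∀ x y z → δf x z ≤ δf x y ⊕ δf y z
    clopen⇒triangle cl x y z = by-order (<-cmp x y) (<-cmp y z) (<-cmp x z)
      where
      by-order : Tri (x < y) (x ≡ y) (y < x) → Tri (y < z) (y ≡ z) (z < y) →
                 Tri (x < z) (x ≡ z) (z < x) → δf x z ≤ δf x y ⊕ δf y z
      by-order (tri≈ _ refl _) _ _ =
        ≤-⊕-cong refl (δ-diagonal x) refl (≤-reflexive (sym (⊕-identityˡ _)))
      by-order _ (tri≈ _ refl _) _ =
        ≤-⊕-cong refl refl (δ-diagonal y) (≤-reflexive (sym (⊕-identityʳ _)))
      by-order _ _ (tri≈ _ refl _) =
        ≤-⊕-cong (δ-diagonal x) refl (δ-skew y x) (0≤⊕* (δf x y))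
      by-order (tri< x<y _ _) (tri< y<z _ _) (tri< x<z _ _) =
        ≤-⊕-cong (δ-< x<z) (δ-< x<y) (δ-< y<z)
          (proj₂ (cl x y z x<y y<z x<z))
      by-order (tri< x<y _ _) (tri< y<z _ _) (tri> _ _ z<x) =
        ⊥-elim (<-asym z<x (<-trans x<y y<z))
      by-order (tri< x<y _ _) (tri> _ _ z<y) (tri< x<z _ _) =
        ≤-⊕-cong (δ-< x<z) (δ-< x<y) (δ-> z<y)
          (⊗-≤⇒≤-⊕ˡ (proj₁ (cl x z y x<z z<y x<y)))
      by-order (tri< x<y _ _) (tri> _ _ z<y) (tri> _ _ z<x) =
        ≤-⊕-cong (δ-> z<x) (δ-< x<y) (δ-> z<y)
          (⊕-rotateʳ (proj₂ (cl z x y z<x x<y z<y)))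
      by-order (tri> _ _ y<x) (tri< y<z _ _) (tri< x<z _ _) =
        ≤-⊕-cong (δ-< x<z) (δ-> y<x) (δ-< y<z)
          (⊗-≤⇒≤-⊕ʳ (proj₁ (cl y x z y<x x<z y<z)))
      by-order (tri> _ _ y<x) (tri< y<z _ _) (tri> _ _ z<x) =
        ≤-⊕-cong (δ-> z<x) (δ-> y<x) (δ-< y<z)
          (⊕-rotateˡ (proj₂ (cl y z x y<z z<x y<x)))
      by-order (tri> _ _ y<x) (tri> _ _ z<y) (tri< x<z _ _) =
        ⊥-elim (<-asym x<z (<-trans z<y y<x))
      by-order (tri> _ _ y<x) (tri> _ _ z<y) (tri> _ _ z<x) =
        ≤-⊕-cong (δ-> z<x) (δ-> y<x) (δ-> z<y)
          (⊗-≤⇒*-≤-⊕ (proj₁ (cl z y x z<y y<x z<x)))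

    clopen⇒skewMetric : IsClopen Q f → IsSkewMetric Q δf
    clopen⇒skewMetric cl = (λ i → ≤-reflexive (δ-diagonal i)) , clopen⇒triangle cl , δ-skew

mainTheorem19 : ∀ {c ℓ} (Q : InvResLattice c ℓ) →
    InvResLattice.0# Q ≡ InvResLattice.1# Q →
    (d : ℕ) → d ≥ 2 → (f : Cfun Q d) →
    IsClopen Q f ⇔ IsSkewMetric Q (δ Q f)
mainTheorem19 Q 0≡1 d _ f = mk⇔ (clopen⇒skewMetric Q f 0≡1) (skewMetric⇒clopen Q f)
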